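{- Let $w\ge1$ be an integer, let $k,z\in\{1,\ldots,2^w-1\}$, and let $a$ be a uniformly random odd integer in $\{0,\ldots,2^w-1\}$. Writing $|y|_{\bmod 2^w}=\min\{y\bmod 2^w,\ (-y)\bmod 2^w\}$, we have \[\sum_{\delta=1}^{k}\Pr_a\big[|az|_{\bmod 2^w}<\delta\big]\ \le\ 2^{2-w}\lfloor k/2\rfloor\lceil k/2\rceil.\] In particular the right-hand side equals $k^2/2^w$ if $k$ is even and $(k^2-1)/2^w$ if $k$ is odd. -}

module Defs where

open import Data.Nat using (ℕ; zero; suc; _+_; _*_; _∸_; _^_; _<_; _<?_; _⊓_; _/_; _%_)
open import Data.Nat using (NonZero)
open import Data.Nat.Properties using (_≟_; m^n≢0)
open import Data.Nat.ListAction using (sum)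
open import Data.Bool using (Bool; true; false; _∧_)
open import Data.List using (List; upTo; filter; length; map)
open import Relation.Nullary.Decidable using (⌊_⌋; _×-dec_)

-- |y|_{mod 2^w} = min (y mod 2^w) ((-y) mod 2^w), for y a natural number.
-- (-y) mod 2^w = (2^w - (y mod 2^w)) mod 2^w.
absMod : ℕ → ℕ → ℕ
absMod w y = let instance nz = m^n≢0 2 w in (y % (2 ^ w)) ⊓ (((2 ^ w) ∸ (y % (2 ^ w))) % (2 ^ w))

Odd? : (a : ℕ) → _
Odd? a = ¬0 where
  open import Relation.Nullary using (¬?)
  ¬0 = ¬? (a % 2 ≟ 0)

oddsBelow : ℕ → List ℕ
oddsBelow w = filter (λ a → Odd? a) (upTo (2 ^ w))

count : ℕ → ℕ → ℕ → ℕ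
count w z δ = length (filter (λ a → absMod w (a * z) <? δ) (oddsBelow w))

sumCount : ℕ → ℕ → ℕ → ℕ
sumCount w z k = sum (map (λ i → count w z (suc i)) (upTo k))

floorHalf : ℕ → ℕ
floorHalf k = k / 2

ceilHalf : ℕ → ℕ
ceilHalf k = (k + 1) / 2

module Submission where

-- Write N = 2^w = 2M and |y| = |y|_{mod N}.  Summing counts over the thresholds
-- δ = 1..k turns the left-hand side into a sum of truncated distances
--   sumCount w z k = shortfall (w-1) z k = Σ_{i<M} (k ∸ |(2i+1) z|),
-- so it suffices to prove  shortfall v z k ≤ 2 ⌊k/2⌋⌈k/2⌉  for 1 ≤ z < 2^{v+1},
-- which we do by induction on v, splitting on the parity of z.
--  * z odd: multiplication by z permutes the odd residues mod N (z has an
--    inverse mod N), so the sum equals Σ_{j<M} (k ∸ |2j+1|).  Since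
--    |2j+1| = min(2j+1, 2(M-1-j)+1), that is at most twice Σ_j (k ∸ (2j+1)),
--    and the latter is at most ⌊k/2⌋⌈k/2⌉.
--  * z = 2q even: |(2i+1)2q|_{2N} = 2|(2i+1)q|_N is M-periodic in i, and
--    k ∸ 2x ≤ (⌊k/2⌋ ∸ x) + (⌈k/2⌉ ∸ x); the induction hypothesis for
--    thresholds ⌊k/2⌋ and ⌈k/2⌉ then closes the case by an inequality
--    between the products ⌊·/2⌋⌈·/2⌉.

open import Defs
open import Data.Nat
  using (ℕ; zero; suc; _+_; _*_; _∸_; _^_; _≤_; _<_; _<?_; z≤n; s≤s; s≤s⁻¹; z<s; _⊓_; _/_; _%_; NonZero)
open import Data.Nat.Properties
open import Data.Nat.DivMod
open import Data.Nat.Divisibility using (m∣m*n)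
open import Data.Nat.ListAction using (sum)
open import Data.Nat.Tactic.RingSolver using (solve-∀)
open import Data.Bool using (true; false; if_then_else_)
open import Data.List using (List; []; _∷_; applyUpTo; filter; length; map)
open import Data.Product using (∃-syntax; _×_; _,_; proj₁; proj₂)
open import Data.Sum using (_⊎_; inj₁; inj₂)
open import Data.Fin using (Fin; toℕ; fromℕ<)
open import Data.Fin.Properties using (toℕ<n; toℕ-fromℕ<; toℕ-injective)
open import Data.Fin.Permutation using (Permutation; permutation)
open import Algebra.Properties.CommutativeMonoid.Sum +-0-commutativeMonoid
  using (sum-cong-≗; sum-replicate-zero; ∑-distrib-+; ∑-comm; ∑-permute) renaming (sum to ∑)
open import Relation.Nullary using (does)
open import Relation.Nullary.Negation using (contradiction)
open import Relation.Unary using (Pred; Decidable)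
open import Relation.Binary.PropositionalEquality

-- Σ_{i<n} f i.  It is the library's sum over Fin n, so that its algebraic
-- laws (distributivity, Fubini, invariance under permutations) are imported.
sumBelow : ℕ → (ℕ → ℕ) → ℕ
sumBelow n f = ∑ (λ (i : Fin n) → f (toℕ i))

sumBelow-cong : ∀ n {f g : ℕ → ℕ} → (∀ i → i < n → f i ≡ g i) → sumBelow n f ≡ sumBelow n g
sumBelow-cong n f≡g = sum-cong-≗ (λ i → f≡g (toℕ i) (toℕ<n i))

sumBelow-mono : ∀ n {f g : ℕ → ℕ} → (∀ i → i < n → f i ≤ g i) → sumBelow n f ≤ sumBelow n g
sumBelow-mono zero    f≤g = z≤n
sumBelow-mono (suc n) f≤g = +-mono-≤ (f≤g 0 z<s) (sumBelow-mono n (λ i i<n → f≤g (suc i) (s≤s i<n)))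

sumBelow-+ : ∀ n (f g : ℕ → ℕ) → sumBelow n (λ i → f i + g i) ≡ sumBelow n f + sumBelow n g
sumBelow-+ n f g = ∑-distrib-+ {n} (λ i → f (toℕ i)) (λ i → g (toℕ i))

sumBelow-comm : ∀ m n (f : ℕ → ℕ → ℕ) →
  sumBelow m (λ i → sumBelow n (f i)) ≡ sumBelow n (λ j → sumBelow m (λ i → f i j))
sumBelow-comm m n f = ∑-comm {m} {n} (λ i j → f (toℕ i) (toℕ j))

sumBelow-split : ∀ m n (f : ℕ → ℕ) → sumBelow (m + n) f ≡ sumBelow m f + sumBelow n (λ i → f (m + i))
sumBelow-split zero    n f = refl
sumBelow-split (suc m) n f =
  trans (cong (f 0 +_) (sumBelow-split m n (λ i → f (suc i)))) (sym (+-assoc (f 0) _ _))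

sumBelow-periodic : ∀ n (f : ℕ → ℕ) → (∀ i → f (n + i) ≡ f i) → sumBelow (2 * n) f ≡ 2 * sumBelow n f
sumBelow-periodic n f periodic = begin
  sumBelow (n + (n + 0)) f                           ≡⟨ sumBelow-split n (n + 0) f ⟩
  sumBelow n f + sumBelow (n + 0) (λ i → f (n + i))  ≡⟨ cong (sumBelow n f +_) second-half ⟩
  sumBelow n f + (sumBelow n f + 0)                  ∎
  where
  open ≡-Reasoning
  second-half : sumBelow (n + 0) (λ i → f (n + i)) ≡ sumBelow n f + 0
  second-half = trans (sumBelow-cong (n + 0) (λ i _ → periodic i))
                      (trans (cong (λ m → sumBelow m f) (+-identityʳ n)) (sym (+-identityʳ _)))

record BijectionBelow (n : ℕ) : Set where
  field
    to from : ℕ → ℕ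
    to-<    : ∀ {i} → i < n → to i < n
    from-<  : ∀ {i} → i < n → from i < n
    from-to : ∀ {i} → i < n → from (to i) ≡ i
    to-from : ∀ {i} → i < n → to (from i) ≡ i

sumBelow-reindex : ∀ {n} (π : BijectionBelow n) (f : ℕ → ℕ) →
  sumBelow n (λ i → f (BijectionBelow.to π i)) ≡ sumBelow n f
sumBelow-reindex {n} π f = begin
  sumBelow n (λ i → f (to i))        ≡⟨ sum-cong-≗ (λ i → cong f (sym (toℕ-fromℕ< (to-< (toℕ<n i))))) ⟩
  ∑ (λ i → f (toℕ (toFin i)))        ≡⟨ sym (∑-permute (λ i → f (toℕ i)) πFin) ⟩
  sumBelow n f                       ∎
  where
  open ≡-Reasoning
  open BijectionBelow π
  toFin fromFin : Fin n → Fin n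
  toFin   i = fromℕ< (to-< (toℕ<n i))
  fromFin i = fromℕ< (from-< (toℕ<n i))
  πFin : Permutation n n
  πFin = permutation toFin fromFin
    (λ i → toℕ-injective (trans (toℕ-fromℕ< _)
             (trans (cong to (toℕ-fromℕ< _)) (to-from (toℕ<n i)))))
    (λ i → toℕ-injective (trans (toℕ-fromℕ< _)
             (trans (cong from (toℕ-fromℕ< _)) (from-to (toℕ<n i)))))

reverseBelow : ∀ n → BijectionBelow n
reverseBelow n = record
  { to = flip ; from = flip ; to-< = flip-< ; from-< = flip-< ; from-to = flip² ; to-from = flip² }
  where
  flip : ℕ → ℕ
  flip j = n ∸ suc j
  flip-< : ∀ {j} → j < n → flip j < n
  flip-< {j} (s≤s j≤n-1) = s≤s (m∸n≤m _ j)
  flip² : ∀ {j} → j < n → flip (flip j) ≡ j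
  flip² (s≤s j≤n-1) = m∸[m∸n]≡n j≤n-1

sum-applyUpTo : ∀ (f g : ℕ → ℕ) n → sum (map f (applyUpTo g n)) ≡ sumBelow n (λ i → f (g i))
sum-applyUpTo f g zero    = refl
sum-applyUpTo f g (suc n) = cong (f (g 0) +_) (sum-applyUpTo f (λ i → g (suc i)) n)

sum-filter : ∀ {p} {P : Pred ℕ p} (P? : Decidable P) (g : ℕ → ℕ) xs →
  sum (map g (filter P? xs)) ≡ sum (map (λ x → if does (P? x) then g x else 0) xs)
sum-filter P? g []       = refl
sum-filter P? g (x ∷ xs) with does (P? x)
... | false = sum-filter P? g xs
... | true  = cong (g x +_) (sum-filter P? g xs)

length≡sum : ∀ {A : Set} (xs : List A) → length xs ≡ sum (map (λ _ → 1) xs)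
length≡sum []       = refl
length≡sum (x ∷ xs) = cong suc (length≡sum xs)

-- Even and odd numbers are written double m and suc (double m); `double`
-- computes by recursion, which makes sums over even and odd indices reduce.
double : ℕ → ℕ
double zero    = zero
double (suc n) = suc (suc (double n))

double≡2* : ∀ n → double n ≡ 2 * n
double≡2* zero    = refl
double≡2* (suc n) =
  trans (cong (λ m → suc (suc m)) (double≡2* n)) (cong suc (sym (+-suc n (n + 0))))

parity : ∀ k → ∃[ m ] (k ≡ double m ⊎ k ≡ suc (double m))
parity zero    = 0 , inj₁ refl
parity (suc k) with parity k
... | m , inj₁ k≡2m   = m , inj₂ (cong suc k≡2m)
... | m , inj₂ k≡2m+1 = suc m , inj₁ (cong suc k≡2m+1)

odd-mod2 : ∀ i → suc (double i) % 2 ≡ 1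
odd-mod2 zero    = refl
odd-mod2 (suc i) = odd-mod2 i

odd-half : ∀ x → x % 2 ≡ 1 → x ≡ suc (double (x / 2))
odd-half x x-odd = begin
  x                    ≡⟨ m≡m%n+[m/n]*n x 2 ⟩
  x % 2 + x / 2 * 2    ≡⟨ cong₂ _+_ x-odd (*-comm (x / 2) 2) ⟩
  suc (2 * (x / 2))    ≡⟨ cong suc (sym (double≡2* (x / 2))) ⟩
  suc (double (x / 2)) ∎
  where open ≡-Reasoning

half-suc-suc : ∀ x → suc (suc x) / 2 ≡ suc (x / 2)
half-suc-suc x = m/n≡1+[m∸n]/n {suc (suc x)} {2} (s≤s (s≤s z≤n))

half-odd : ∀ m → suc (double m) / 2 ≡ m
half-odd zero    = refl
half-odd (suc m) = trans (half-suc-suc (suc (double m))) (cong suc (half-odd m))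

half-even : ∀ m → double m / 2 ≡ m
half-even zero    = refl
half-even (suc m) = trans (half-suc-suc (double m)) (cong suc (half-even m))

odd<even : ∀ a b → a < b → suc (double a) < double b
odd<even zero    (suc b) _   = s≤s (s≤s z≤n)
odd<even (suc a) (suc b) a<b = s≤s (s≤s (odd<even a b (s≤s⁻¹ a<b)))

odd<even⁻¹ : ∀ a b → suc (double a) < double b → a < b
odd<even⁻¹ zero    (suc b) _ = s≤s z≤n
odd<even⁻¹ (suc a) (suc b) p = s≤s (odd<even⁻¹ a b (s≤s⁻¹ (s≤s⁻¹ p)))

double<⁻¹ : ∀ a b → double a < double b → a < b
double<⁻¹ zero    (suc b) _ = s≤s z≤n
double<⁻¹ (suc a) (suc b) p = s≤s (double<⁻¹ a b (s≤s⁻¹ (s≤s⁻¹ p)))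

oddPart : (ℕ → ℕ) → ℕ → ℕ
oddPart h a = if does (Odd? a) then h a else 0

sumBelow-oddPart : ∀ (h : ℕ → ℕ) M → sumBelow (double M) (oddPart h) ≡ sumBelow M (λ i → h (suc (double i)))
sumBelow-oddPart h zero    = refl
sumBelow-oddPart h (suc M) = cong (h 1 +_) (sumBelow-oddPart (λ a → h (suc (suc a))) M)

𝟙[_<_] : ℕ → ℕ → ℕ
𝟙[ x < d ] = if does (x <? d) then 1 else 0

sumBelow-𝟙 : ∀ k x → sumBelow k (λ d → 𝟙[ x < suc d ]) ≡ k ∸ x
sumBelow-𝟙 zero    x       = sym (0∸n≡0 x)
sumBelow-𝟙 (suc k) zero    = cong suc (sumBelow-𝟙 k zero)
sumBelow-𝟙 (suc k) (suc x) = sumBelow-𝟙 k x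

-- Σ_{i<2^v} (k ∸ |(2i+1) z|_{mod 2^{v+1}}): the sum of the distances of the
-- residues a z (a odd) to 0, truncated at k.
shortfall : ℕ → ℕ → ℕ → ℕ
shortfall v z k = sumBelow (2 ^ v) (λ i → k ∸ absMod (suc v) (suc (double i) * z))

count≡sumBelow : ∀ v z δ →
  count (suc v) z δ ≡ sumBelow (2 ^ v) (λ i → 𝟙[ absMod (suc v) (suc (double i) * z) < δ ])
count≡sumBelow v z δ = begin
  length (filter Q (oddsBelow (suc v)))              ≡⟨ length≡sum (filter Q (oddsBelow (suc v))) ⟩
  sum (map (λ _ → 1) (filter Q (oddsBelow (suc v)))) ≡⟨ sum-filter Q (λ _ → 1) (oddsBelow (suc v)) ⟩
  sum (map g (oddsBelow (suc v)))                    ≡⟨ sum-filter (λ a → Odd? a) g (applyUpTo (λ a → a) (2 ^ suc v)) ⟩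
  sum (map (oddPart g) (applyUpTo (λ a → a) (2 ^ suc v))) ≡⟨ sum-applyUpTo (oddPart g) (λ a → a) (2 ^ suc v) ⟩
  sumBelow (2 * 2 ^ v) (oddPart g)                   ≡⟨ cong (λ n → sumBelow n (oddPart g)) (sym (double≡2* (2 ^ v))) ⟩
  sumBelow (double (2 ^ v)) (oddPart g)              ≡⟨ sumBelow-oddPart g (2 ^ v) ⟩
  sumBelow (2 ^ v) (λ i → 𝟙[ absMod (suc v) (suc (double i) * z) < δ ]) ∎
  where
  open ≡-Reasoning
  Q = λ a → absMod (suc v) (a * z) <? δ
  g : ℕ → ℕ
  g a = 𝟙[ absMod (suc v) (a * z) < δ ]

sumCount≡shortfall : ∀ v z k → sumCount (suc v) z k ≡ shortfall v z k
sumCount≡shortfall v z k = begin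
  sumCount (suc v) z k                                   ≡⟨ sum-applyUpTo (λ d → count (suc v) z (suc d)) (λ d → d) k ⟩
  sumBelow k (λ d → count (suc v) z (suc d))             ≡⟨ sumBelow-cong k (λ d _ → count≡sumBelow v z (suc d)) ⟩
  sumBelow k (λ d → sumBelow (2 ^ v) (λ i → 𝟙[ x i < suc d ])) ≡⟨ sumBelow-comm k (2 ^ v) (λ d i → 𝟙[ x i < suc d ]) ⟩
  sumBelow (2 ^ v) (λ i → sumBelow k (λ d → 𝟙[ x i < suc d ])) ≡⟨ sumBelow-cong (2 ^ v) (λ i _ → sumBelow-𝟙 k (x i)) ⟩
  shortfall v z k                                        ∎
  where
  open ≡-Reasoning
  x : ℕ → ℕ
  x i = absMod (suc v) (suc (double i) * z)

-- ⌊k/2⌋⌈k/2⌉, the largest value of a(k - a) over natural a.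
halfProduct : ℕ → ℕ
halfProduct k = floorHalf k * ceilHalf k

ceilHalf≡ : ∀ k → ceilHalf k ≡ suc k / 2
ceilHalf≡ k = cong (_/ 2) (+-comm k 1)

halves-even : ∀ m → floorHalf (double m) ≡ m × ceilHalf (double m) ≡ m
halves-even m = half-even m , trans (ceilHalf≡ (double m)) (half-odd m)

halves-odd : ∀ m → floorHalf (suc (double m)) ≡ m × ceilHalf (suc (double m)) ≡ suc m
halves-odd m = half-odd m , trans (ceilHalf≡ (suc (double m))) (half-even (suc m))

floor+ceil : ∀ k → floorHalf k + ceilHalf k ≡ k
floor+ceil k with parity k
... | m , inj₁ refl = begin
  floorHalf (double m) + ceilHalf (double m) ≡⟨ cong₂ _+_ (proj₁ (halves-even m)) (proj₂ (halves-even m)) ⟩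
  m + m                                      ≡⟨ cong (m +_) (sym (+-identityʳ m)) ⟩
  2 * m                                      ≡⟨ sym (double≡2* m) ⟩
  double m                                   ∎
  where open ≡-Reasoning
... | m , inj₂ refl = begin
  floorHalf (suc (double m)) + ceilHalf (suc (double m)) ≡⟨ cong₂ _+_ (proj₁ (halves-odd m)) (proj₂ (halves-odd m)) ⟩
  m + suc m                                  ≡⟨ +-suc m m ⟩
  suc (m + m)                                ≡⟨ cong (λ n → suc (m + n)) (sym (+-identityʳ m)) ⟩
  suc (2 * m)                                ≡⟨ cong suc (sym (double≡2* m)) ⟩
  suc (double m)                             ∎
  where open ≡-Reasoning

halfProduct-even : ∀ m → halfProduct (double m) ≡ m * m
halfProduct-even m = cong₂ _*_ (proj₁ (halves-even m)) (proj₂ (halves-even m))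

halfProduct-odd : ∀ m → halfProduct (suc (double m)) ≡ m * suc m
halfProduct-odd m = cong₂ _*_ (proj₁ (halves-odd m)) (proj₂ (halves-odd m))

halfProduct-suc-suc : ∀ k → halfProduct (suc (suc k)) ≡ suc k + halfProduct k
halfProduct-suc-suc k = begin
  floorHalf (suc (suc k)) * ceilHalf (suc (suc k)) ≡⟨ cong₂ _*_ (half-suc-suc k) (half-suc-suc (k + 1)) ⟩
  suc f * suc c                                    ≡⟨ expand f c ⟩
  suc (f + c) + f * c                              ≡⟨ cong (λ n → suc n + f * c) (floor+ceil k) ⟩
  suc k + f * c                                    ∎
  where
  open ≡-Reasoning
  f c : ℕ
  f = floorHalf k
  c = ceilHalf k
  expand : ∀ f c → suc f * suc c ≡ suc (f + c) + f * c
  expand = solve-∀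

-- Σ_{j<M} (k ∸ (2j+1)) ≤ ⌊k/2⌋⌈k/2⌉: the positive terms are k-1, k-3, … .
sumOdd-bound : ∀ k M → sumBelow M (λ j → k ∸ suc (double j)) ≤ halfProduct k
sumOdd-bound zero          M       = ≤-reflexive (sum-replicate-zero M)
sumOdd-bound (suc zero)    M       = ≤-trans (≤-reflexive (trans
  (sumBelow-cong M (λ j _ → 0∸n≡0 (double j))) (sum-replicate-zero M))) z≤n
sumOdd-bound (suc (suc k)) zero    = z≤n
sumOdd-bound (suc (suc k)) (suc M) =
  ≤-trans (+-monoʳ-≤ (suc k) (sumOdd-bound k M)) (≤-reflexive (sym (halfProduct-suc-suc k)))

four-halfProduct≤square : ∀ m → 4 * halfProduct m ≤ m * m
four-halfProduct≤square m with parity m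
... | j , inj₁ refl = ≤-reflexive (begin
  4 * halfProduct (double j) ≡⟨ cong (4 *_) (halfProduct-even j) ⟩
  4 * (j * j)                ≡⟨ identity j ⟩
  2 * j * (2 * j)            ≡⟨ sym (cong₂ _*_ (double≡2* j) (double≡2* j)) ⟩
  double j * double j        ∎)
  where
  open ≡-Reasoning
  identity : ∀ j → 4 * (j * j) ≡ 2 * j * (2 * j)
  identity = solve-∀
... | j , inj₂ refl = ≤-trans (m≤m+n _ 1) (≤-reflexive (begin
  4 * halfProduct (suc (double j)) + 1 ≡⟨ cong (λ n → 4 * n + 1) (halfProduct-odd j) ⟩
  4 * (j * suc j) + 1                  ≡⟨ identity j ⟩
  suc (2 * j) * suc (2 * j)            ≡⟨ sym (cong₂ (λ a b → suc a * suc b) (double≡2* j) (double≡2* j)) ⟩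
  suc (double j) * suc (double j)      ∎))
  where
  open ≡-Reasoning
  identity : ∀ j → 4 * (j * suc j) + 1 ≡ suc (2 * j) * suc (2 * j)
  identity = solve-∀

halfProduct-consecutive : ∀ m → 2 * (halfProduct m + halfProduct (suc m)) ≡ m * suc m
halfProduct-consecutive m with parity m
... | j , inj₁ refl = begin
  2 * (halfProduct (double j) + halfProduct (suc (double j))) ≡⟨ cong₂ (λ a b → 2 * (a + b)) (halfProduct-even j) (halfProduct-odd j) ⟩
  2 * (j * j + j * suc j)                                     ≡⟨ identity j ⟩
  2 * j * suc (2 * j)                                         ≡⟨ sym (cong (λ a → a * suc a) (double≡2* j)) ⟩
  double j * suc (double j)                                   ∎
  where
  open ≡-Reasoning
  identity : ∀ j → 2 * (j * j + j * suc j) ≡ 2 * j * suc (2 * j)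
  identity = solve-∀
... | j , inj₂ refl = begin
  2 * (halfProduct (suc (double j)) + halfProduct (double (suc j))) ≡⟨ cong₂ (λ a b → 2 * (a + b)) (halfProduct-odd j) (halfProduct-even (suc j)) ⟩
  2 * (j * suc j + suc j * suc j)                                   ≡⟨ identity j ⟩
  suc (2 * j) * suc (suc (2 * j))                                   ≡⟨ sym (cong (λ a → suc a * suc (suc a)) (double≡2* j)) ⟩
  suc (double j) * suc (suc (double j))                             ∎
  where
  open ≡-Reasoning
  identity : ∀ j → 2 * (j * suc j + suc j * suc j) ≡ suc (2 * j) * suc (suc (2 * j))
  identity = solve-∀

halfProduct-halves : ∀ k → 2 * (halfProduct (floorHalf k) + halfProduct (ceilHalf k)) ≤ halfProduct k
halfProduct-halves k with parity k
... | m , inj₁ refl = ≤-trans (≤-reflexive (begin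
  2 * (halfProduct (floorHalf (double m)) + halfProduct (ceilHalf (double m)))
    ≡⟨ cong₂ (λ a b → 2 * (halfProduct a + halfProduct b)) (proj₁ (halves-even m)) (proj₂ (halves-even m)) ⟩
  2 * (halfProduct m + halfProduct m) ≡⟨ identity (halfProduct m) ⟩
  4 * halfProduct m                   ∎))
  (≤-trans (four-halfProduct≤square m) (≤-reflexive (sym (halfProduct-even m))))
  where
  open ≡-Reasoning
  identity : ∀ x → 2 * (x + x) ≡ 4 * x
  identity = solve-∀
... | m , inj₂ refl = ≤-reflexive (begin
  2 * (halfProduct (floorHalf (suc (double m))) + halfProduct (ceilHalf (suc (double m))))
    ≡⟨ cong₂ (λ a b → 2 * (halfProduct a + halfProduct b)) (proj₁ (halves-odd m)) (proj₂ (halves-odd m)) ⟩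
  2 * (halfProduct m + halfProduct (suc m)) ≡⟨ halfProduct-consecutive m ⟩
  m * suc m                                 ≡⟨ sym (halfProduct-odd m) ⟩
  halfProduct (suc (double m))              ∎)
  where open ≡-Reasoning

∸-⊓-≤ : ∀ k a b → k ∸ (a ⊓ b) ≤ (k ∸ a) + (k ∸ b)
∸-⊓-≤ k a b = ≤-trans (≤-reflexive (∸-distribˡ-⊓-⊔ k a b)) (m⊔n≤m+n (k ∸ a) (k ∸ b))

∸-+-≤ : ∀ a b x y → (a + b) ∸ (x + y) ≤ (a ∸ x) + (b ∸ y)
∸-+-≤ a b x y = m≤n+o⇒m∸n≤o (a + b) (x + y)
  (≤-trans (+-mono-≤ (m≤n+m∸n a x) (m≤n+m∸n b y)) (≤-reflexive (interchange x y (a ∸ x) (b ∸ y))))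
  where
  interchange : ∀ x y p q → (x + p) + (y + q) ≡ (x + y) + (p + q)
  interchange = solve-∀

∸-double-≤ : ∀ k x → k ∸ 2 * x ≤ (floorHalf k ∸ x) + (ceilHalf k ∸ x)
∸-double-≤ k x = subst (λ n → n ∸ (x + (x + 0)) ≤ (floorHalf k ∸ x) + (ceilHalf k ∸ x)) (floor+ceil k)
  (≤-trans (∸-monoʳ-≤ (floorHalf k + ceilHalf k) (≤-reflexive (cong (x +_) (sym (+-identityʳ x)))))
           (∸-+-≤ (floorHalf k) (ceilHalf k) x x))

%-absorbˡ-* : ∀ N .{{_ : NonZero N}} x b → ((x % N) * b) % N ≡ (x * b) % N
%-absorbˡ-* N x b = begin
  (x % N * b) % N              ≡⟨ %-distribˡ-* (x % N) b N ⟩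
  (x % N % N * (b % N)) % N    ≡⟨ cong (λ r → (r * (b % N)) % N) (m%n%n≡m%n x N) ⟩
  (x % N * (b % N)) % N        ≡⟨ sym (%-distribˡ-* x b N) ⟩
  (x * b) % N                  ∎
  where open ≡-Reasoning

module _ (w : ℕ) where
  private instance
    2^w≢0 : NonZero (2 ^ w)
    2^w≢0 = m^n≢0 2 w
    2^1+w≢0 : NonZero (2 ^ suc w)
    2^1+w≢0 = m^n≢0 2 (suc w)
    2^w*2≢0 : NonZero (2 ^ w * 2)
    2^w*2≢0 = m*n≢0 (2 ^ w) 2

  absMod-mod : ∀ y → absMod w (y % 2 ^ w) ≡ absMod w y
  absMod-mod y = cong (λ r → r ⊓ ((2 ^ w ∸ r) % 2 ^ w)) (m%n%n≡m%n y (2 ^ w))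

  absMod-period : ∀ y t → absMod w (y + t * 2 ^ w) ≡ absMod w y
  absMod-period y t = cong (λ r → r ⊓ ((2 ^ w ∸ r) % 2 ^ w)) ([m+kn]%n≡m%n y t (2 ^ w))

  double-mod : ∀ x → (2 * x) % 2 ^ suc w ≡ 2 * (x % 2 ^ w)
  double-mod x = begin
    (2 * x) % 2 ^ suc w     ≡⟨ cong (_% 2 ^ suc w) (*-comm 2 x) ⟩
    (x * 2) % 2 ^ suc w     ≡⟨ %-congʳ (*-comm 2 (2 ^ w)) ⟩
    (x * 2) % (2 ^ w * 2)   ≡⟨ sym (m%n*o≡m*o%[n*o] x (2 ^ w) 2) ⟩
    x % 2 ^ w * 2           ≡⟨ *-comm (x % 2 ^ w) 2 ⟩
    2 * (x % 2 ^ w)         ∎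
    where open ≡-Reasoning

  absMod-double : ∀ x → absMod (suc w) (2 * x) ≡ 2 * absMod w x
  absMod-double x = begin
    absMod (suc w) (2 * x)                             ≡⟨ cong (λ s → s ⊓ ((2 ^ suc w ∸ s) % 2 ^ suc w)) (double-mod x) ⟩
    (2 * r) ⊓ ((2 * 2 ^ w ∸ 2 * r) % 2 ^ suc w)        ≡⟨ cong (λ s → (2 * r) ⊓ (s % 2 ^ suc w)) (sym (*-distribˡ-∸ 2 (2 ^ w) r)) ⟩
    (2 * r) ⊓ ((2 * (2 ^ w ∸ r)) % 2 ^ suc w)          ≡⟨ cong ((2 * r) ⊓_) (double-mod (2 ^ w ∸ r)) ⟩
    (2 * r) ⊓ (2 * ((2 ^ w ∸ r) % 2 ^ w))              ≡⟨ sym (*-distribˡ-⊓ 2 r _) ⟩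
    2 * absMod w x                                     ∎
    where
    open ≡-Reasoning
    r : ℕ
    r = x % 2 ^ w

  absMod-odd : ∀ j → j < 2 ^ w → absMod (suc w) (suc (double j)) ≡ suc (double j) ⊓ suc (double (2 ^ w ∸ suc j))
  absMod-odd j j<M = begin
    (suc (double j) % N) ⊓ ((N ∸ suc (double j) % N) % N)    ≡⟨ cong (λ r → r ⊓ ((N ∸ r) % N)) (odd<N j j<M) ⟩
    suc (double j) ⊓ ((N ∸ suc (double j)) % N)              ≡⟨ cong (λ r → suc (double j) ⊓ ((r ∸ suc (double j)) % N)) N≡double ⟩
    suc (double j) ⊓ ((double M ∸ suc (double j)) % N)       ≡⟨ cong (λ r → suc (double j) ⊓ (r % N)) (reflect M j j<M) ⟩
    suc (double j) ⊓ (suc (double (M ∸ suc j)) % N)          ≡⟨ cong (suc (double j) ⊓_) (odd<N (M ∸ suc j) (BijectionBelow.to-< (reverseBelow M) j<M)) ⟩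
    suc (double j) ⊓ suc (double (M ∸ suc j))                ∎
    where
    open ≡-Reasoning
    M N : ℕ
    M = 2 ^ w
    N = 2 ^ suc w
    N≡double : N ≡ double M
    N≡double = sym (double≡2* M)
    odd<N : ∀ i → i < M → suc (double i) % N ≡ suc (double i)
    odd<N i i<M = m<n⇒m%n≡m (subst (suc (double i) <_) (sym N≡double) (odd<even i M i<M))
    reflect : ∀ n j → j < n → double n ∸ suc (double j) ≡ suc (double (n ∸ suc j))
    reflect (suc n) zero    _   = refl
    reflect (suc n) (suc j) j<n = reflect n j (s≤s⁻¹ j<n)

-- Every odd number has an odd inverse modulo every power of two: lift an
-- inverse mod 2^{w+1} to one mod 2^{w+2} by adding 2^{w+1} when necessary.
oddInverse : ∀ w q → ∃[ p ] ∃[ t ] (1 + 2 * q) * (1 + 2 * p) ≡ 1 + t * 2 ^ suc w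
oddInverse zero    q = 0 , q , base q
  where
  base : ∀ q → (1 + 2 * q) * (1 + 2 * 0) ≡ 1 + q * 2 ^ 1
  base = solve-∀
oddInverse (suc w) q with oddInverse w q
... | p , t , inverse with parity t
...   | s , inj₁ refl = p , s , trans inverse (trans (cong (λ n → 1 + n * 2 ^ suc w) (double≡2* s)) (regroup s (2 ^ w)))
  where
  regroup : ∀ s Q → 1 + 2 * s * (2 * Q) ≡ 1 + s * (2 * (2 * Q))
  regroup = solve-∀
...   | s , inj₂ refl = p + Q , s + q + 1 , (begin
  (1 + 2 * q) * (1 + 2 * (p + Q))                     ≡⟨ expand q p Q ⟩
  (1 + 2 * q) * (1 + 2 * p) + (1 + 2 * q) * (2 * Q)   ≡⟨ cong (_+ (1 + 2 * q) * (2 * Q)) inverse ⟩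
  1 + suc (double s) * (2 * Q) + (1 + 2 * q) * (2 * Q) ≡⟨ cong (λ n → 1 + suc n * (2 * Q) + (1 + 2 * q) * (2 * Q)) (double≡2* s) ⟩
  1 + suc (2 * s) * (2 * Q) + (1 + 2 * q) * (2 * Q)    ≡⟨ regroup s q Q ⟩
  1 + (s + q + 1) * (2 * (2 * Q))                      ∎)
  where
  open ≡-Reasoning
  Q : ℕ
  Q = 2 ^ w
  expand : ∀ q p Q → (1 + 2 * q) * (1 + 2 * (p + Q)) ≡ (1 + 2 * q) * (1 + 2 * p) + (1 + 2 * q) * (2 * Q)
  expand = solve-∀
  regroup : ∀ s q Q → 1 + suc (2 * s) * (2 * Q) + (1 + 2 * q) * (2 * Q) ≡ 1 + (s + q + 1) * (2 * (2 * Q))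
  regroup = solve-∀

module _ (v : ℕ) where
  private instance
    2^1+v≢0 : NonZero (2 ^ suc v)
    2^1+v≢0 = m^n≢0 2 (suc v)

  -- The index j of the odd residue 2j+1 ≡ (2i+1)·a mod 2^{v+1}, for odd a.
  oddIndex : ℕ → ℕ → ℕ
  oddIndex a i = ((suc (double i) * a) % 2 ^ suc v) / 2

  oddIndex-spec : ∀ a i → a % 2 ≡ 1 → suc (double (oddIndex a i)) ≡ (suc (double i) * a) % 2 ^ suc v
  oddIndex-spec a i a-odd = sym (odd-half _ residue-odd)
    where
    residue-odd : ((suc (double i) * a) % 2 ^ suc v) % 2 ≡ 1
    residue-odd = begin
      ((suc (double i) * a) % 2 ^ suc v) % 2      ≡⟨ m∣n⇒o%n%m≡o%m 2 (2 ^ suc v) _ (m∣m*n (2 ^ v)) ⟩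
      (suc (double i) * a) % 2                    ≡⟨ %-distribˡ-* (suc (double i)) a 2 ⟩
      ((suc (double i) % 2) * (a % 2)) % 2        ≡⟨ cong₂ (λ x y → (x * y) % 2) (odd-mod2 i) a-odd ⟩
      1                                           ∎
      where open ≡-Reasoning

  oddIndex-< : ∀ a i → a % 2 ≡ 1 → oddIndex a i < 2 ^ v
  oddIndex-< a i a-odd = odd<even⁻¹ (oddIndex a i) (2 ^ v)
    (subst₂ _<_ (sym (oddIndex-spec a i a-odd)) (sym (double≡2* (2 ^ v))) (m%n<n _ (2 ^ suc v)))

  oddIndex-inverse : ∀ a b t i → a % 2 ≡ 1 → a * b ≡ 1 + t * 2 ^ suc v → i < 2 ^ v →
    oddIndex b (oddIndex a i) ≡ i
  oddIndex-inverse a b t i a-odd ab≡1 i<M = begin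
    ((suc (double (oddIndex a i)) * b) % N) / 2   ≡⟨ cong (λ r → ((r * b) % N) / 2) (oddIndex-spec a i a-odd) ⟩
    (((x * a) % N * b) % N) / 2                   ≡⟨ cong (_/ 2) (%-absorbˡ-* N (x * a) b) ⟩
    ((x * a * b) % N) / 2                         ≡⟨ cong (λ r → (r % N) / 2) (*-assoc x a b) ⟩
    ((x * (a * b)) % N) / 2                       ≡⟨ cong (λ r → ((x * r) % N) / 2) ab≡1 ⟩
    ((x * (1 + t * N)) % N) / 2                   ≡⟨ cong (λ r → (r % N) / 2) (expand x t N) ⟩
    ((x + x * t * N) % N) / 2                     ≡⟨ cong (_/ 2) ([m+kn]%n≡m%n x (x * t) N) ⟩
    (x % N) / 2                                   ≡⟨ cong (_/ 2) (m<n⇒m%n≡m x<N) ⟩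
    x / 2                                         ≡⟨ half-odd i ⟩
    i                                             ∎
    where
    open ≡-Reasoning
    N x : ℕ
    N = 2 ^ suc v
    x = suc (double i)
    x<N : x < N
    x<N = subst (x <_) (double≡2* (2 ^ v)) (odd<even i (2 ^ v) i<M)
    expand : ∀ x t N → x * (1 + t * N) ≡ x + x * t * N
    expand = solve-∀

  multiplyOdd : ∀ q → BijectionBelow (2 ^ v)
  multiplyOdd q = record
    { to      = oddIndex a
    ; from    = oddIndex b
    ; to-<    = λ {i} _ → oddIndex-< a i (odd-mod2 q)
    ; from-<  = λ {i} _ → oddIndex-< b i (odd-mod2 p)
    ; from-to = oddIndex-inverse a b t _ (odd-mod2 q) ab≡1
    ; to-from = oddIndex-inverse b a t _ (odd-mod2 p) (trans (*-comm b a) ab≡1)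
    }
    where
    p t a b : ℕ
    p = proj₁ (oddInverse v q)
    t = proj₁ (proj₂ (oddInverse v q))
    a = suc (double q)
    b = suc (double p)
    ab≡1 : a * b ≡ 1 + t * 2 ^ suc v
    ab≡1 = trans (cong₂ (λ m n → suc m * suc n) (double≡2* q) (double≡2* p)) (proj₂ (proj₂ (oddInverse v q)))

shortfall-odd : ∀ v q k →
  shortfall v (suc (double q)) k ≡ sumBelow (2 ^ v) (λ j → k ∸ absMod (suc v) (suc (double j)))
shortfall-odd v q k = begin
  shortfall v z k                                 ≡⟨ sumBelow-cong (2 ^ v) (λ i _ → cong (k ∸_) (distance i)) ⟩
  sumBelow (2 ^ v) (λ i → f (oddIndex v z i))     ≡⟨ sumBelow-reindex (multiplyOdd v q) f ⟩
  sumBelow (2 ^ v) f                              ∎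
  where
  open ≡-Reasoning
  z : ℕ
  z = suc (double q)
  f : ℕ → ℕ
  f j = k ∸ absMod (suc v) (suc (double j))
  distance : ∀ i → absMod (suc v) (suc (double i) * z) ≡ absMod (suc v) (suc (double (oddIndex v z i)))
  distance i = trans (sym (absMod-mod (suc v) _)) (cong (absMod (suc v)) (sym (oddIndex-spec v z i (odd-mod2 q))))

-- Pairing the odd residue 2j+1 with its reflection 2(M-1-j)+1.
oddResidues-bound : ∀ v k → sumBelow (2 ^ v) (λ j → k ∸ absMod (suc v) (suc (double j))) ≤ 2 * halfProduct k
oddResidues-bound v k = begin
  sumBelow M (λ j → k ∸ absMod (suc v) (suc (double j)))
    ≤⟨ sumBelow-mono M paired ⟩
  sumBelow M (λ j → g j + g (M ∸ suc j))              ≡⟨ sumBelow-+ M g (λ j → g (M ∸ suc j)) ⟩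
  sumBelow M g + sumBelow M (λ j → g (M ∸ suc j))     ≡⟨ cong (sumBelow M g +_) (sumBelow-reindex (reverseBelow M) g) ⟩
  sumBelow M g + sumBelow M g                         ≤⟨ +-mono-≤ (sumOdd-bound k M) (sumOdd-bound k M) ⟩
  halfProduct k + halfProduct k                       ≡⟨ cong (halfProduct k +_) (sym (+-identityʳ _)) ⟩
  2 * halfProduct k                                   ∎
  where
  open ≤-Reasoning
  M : ℕ
  M = 2 ^ v
  g : ℕ → ℕ
  g j = k ∸ suc (double j)
  paired : ∀ j → j < M → k ∸ absMod (suc v) (suc (double j)) ≤ g j + g (M ∸ suc j)
  paired j j<M = subst (λ d → k ∸ d ≤ g j + g (M ∸ suc j)) (sym (absMod-odd v j j<M))
    (∸-⊓-≤ k (suc (double j)) (suc (double (M ∸ suc j))))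

shortfall-even : ∀ v q k →
  shortfall (suc v) (double q) k ≡ 2 * sumBelow (2 ^ v) (λ i → k ∸ 2 * absMod (suc v) (suc (double i) * q))
shortfall-even v q k = begin
  shortfall (suc v) (double q) k           ≡⟨ sumBelow-cong (2 ^ suc v) (λ i _ → cong (k ∸_) (doubled i)) ⟩
  sumBelow (2 * 2 ^ v) f                   ≡⟨ sumBelow-periodic (2 ^ v) f (λ i → cong (λ d → k ∸ 2 * d) (periodic i)) ⟩
  2 * sumBelow (2 ^ v) f                   ∎
  where
  open ≡-Reasoning
  f : ℕ → ℕ
  f i = k ∸ 2 * absMod (suc v) (suc (double i) * q)
  doubled : ∀ i → absMod (suc (suc v)) (suc (double i) * double q) ≡ 2 * absMod (suc v) (suc (double i) * q)
  doubled i = trans (cong (absMod (suc (suc v))) move) (absMod-double (suc v) (suc (double i) * q))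
    where
    swap : ∀ a q → a * (2 * q) ≡ 2 * (a * q)
    swap = solve-∀
    move : suc (double i) * double q ≡ 2 * (suc (double i) * q)
    move = trans (cong (suc (double i) *_) (double≡2* q)) (swap (suc (double i)) q)
  shift : ∀ i → suc (double (2 ^ v + i)) * q ≡ suc (double i) * q + q * 2 ^ suc v
  shift i = trans (cong (λ a → suc a * q) (double≡2* (2 ^ v + i)))
    (trans (regroup (2 ^ v) i q) (cong (λ a → suc a * q + q * 2 ^ suc v) (sym (double≡2* i))))
    where
    regroup : ∀ M i q → suc (2 * (M + i)) * q ≡ suc (2 * i) * q + q * (2 * M)
    regroup = solve-∀
  periodic : ∀ i → absMod (suc v) (suc (double (2 ^ v + i)) * q) ≡ absMod (suc v) (suc (double i) * q)
  periodic i = trans (cong (absMod (suc v)) (shift i)) (absMod-period (suc v) _ q)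

shortfall-bound : ∀ v z k → 1 ≤ z → z < 2 ^ suc v → shortfall v z k ≤ 2 * halfProduct k
shortfall-bound v z k 1≤z z<N with parity z
... | q , inj₂ refl = ≤-trans (≤-reflexive (shortfall-odd v q k)) (oddResidues-bound v k)
shortfall-bound v       z k 1≤z z<N | zero  , inj₁ refl = contradiction 1≤z (λ ())
shortfall-bound zero    z k 1≤z z<N | suc q , inj₁ refl = contradiction z<N (λ { (s≤s (s≤s ())) })
shortfall-bound (suc v) z k 1≤z z<N | suc q , inj₁ refl = begin
  shortfall (suc v) (double (suc q)) k                  ≡⟨ shortfall-even v (suc q) k ⟩
  2 * sumBelow M (λ i → k ∸ 2 * X i)                    ≤⟨ *-monoʳ-≤ 2 (sumBelow-mono M (λ i _ → ∸-double-≤ k (X i))) ⟩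
  2 * sumBelow M (λ i → (f ∸ X i) + (c ∸ X i))          ≡⟨ cong (2 *_) (sumBelow-+ M (λ i → f ∸ X i) (λ i → c ∸ X i)) ⟩
  2 * (shortfall v (suc q) f + shortfall v (suc q) c)   ≤⟨ *-monoʳ-≤ 2 (+-mono-≤ (induction f) (induction c)) ⟩
  2 * (2 * halfProduct f + 2 * halfProduct c)           ≡⟨ cong (2 *_) (sym (*-distribˡ-+ 2 (halfProduct f) (halfProduct c))) ⟩
  2 * (2 * (halfProduct f + halfProduct c))             ≤⟨ *-monoʳ-≤ 2 (halfProduct-halves k) ⟩
  2 * halfProduct k                                     ∎
  where
  open ≤-Reasoning
  M f c : ℕ
  M = 2 ^ v
  f = floorHalf k
  c = ceilHalf k
  X : ℕ → ℕ
  X i = absMod (suc v) (suc (double i) * suc q)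
  q<N : suc q < 2 ^ suc v
  q<N = double<⁻¹ (suc q) (2 ^ suc v) (subst (double (suc q) <_) (sym (double≡2* (2 ^ suc v))) z<N)
  induction : ∀ d → shortfall v (suc q) d ≤ 2 * halfProduct d
  induction d = shortfall-bound v (suc q) d (s≤s z≤n) q<N

-- Multiplying the main estimate by 2^w gives the stated bound.
lemma8 : (w k z : ℕ) → 1 ≤ w → 1 ≤ k → k < 2 ^ w → 1 ≤ z → z < 2 ^ w →
    (2 ^ w) * sumCount w z k ≤ (2 ^ (w ∸ 1)) * (4 * (floorHalf k * ceilHalf k))
lemma8 (suc v) k z _ _ _ 1≤z z<N = begin
  2 ^ suc v * sumCount (suc v) z k     ≡⟨ cong (2 ^ suc v *_) (sumCount≡shortfall v z k) ⟩
  2 ^ suc v * shortfall v z k          ≤⟨ *-monoʳ-≤ (2 ^ suc v) (shortfall-bound v z k 1≤z z<N) ⟩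
  2 ^ suc v * (2 * halfProduct k)      ≡⟨ regroup (2 ^ v) (halfProduct k) ⟩
  2 ^ v * (4 * halfProduct k)          ∎
  where
  open ≤-Reasoning
  regroup : ∀ M x → 2 * M * (2 * x) ≡ M * (4 * x)
  regroup = solve-∀
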